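{- Let $K$ be a simplicial complex and let $L$ be a subcomplex of $K$ which is cross-polytopal with $2d$ vertices (in the sense defined in the context). Let $\mathcal{A}$ be the collection of maximal antipode-free simplices of $L$. If some element of $\mathcal{A}$ is a maximal simplex of $K$, then the inclusion map $\imath: L\rightarrow K$ induces an injective homomorphism $\imath_*: H_{d-1}(L)\to H_{d-1}(K)$ on $(d-1)$-dimensional simplicial homology; in particular $H_{d-1}(K)$ is non-trivial.
   Context: A simplicial complex $L$ is cross-polytopal with $2d$ vertices if its vertices can be labelled $v_1,\dots,v_{2d}$ so that $L$ is the clique complex of the graph on $\{v_1,\dots,v_{2d}\}$ in which $v_i$ and $v_j$ ($i\neq j$) are adjacent if and only if $|i-j|\neq d$; i.e. $L$ is the boundary of a $d$-dimensional cross-polytope, homotopy equivalent to $S^{d-1}$, with antipodal pairs $\{v_i,v_{i+d}\}$. The maximal antipode-free simplices of $L$ are the vertex sets containing exactly one vertex from each antipodal pair $\{v_i,v_{i+d}\}$, $i=1,\dots,d$. A simplex of $K$ is maximal if it is not a proper face of any other simplex of $K$. -}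

module Defs where

open import Data.Nat using (ℕ; zero; suc; _+_; _*_; ∣_-_∣)
open import Data.Integer as ℤ using (ℤ; -_; 0ℤ; 1ℤ)
open import Data.Bool using (Bool; true; false; if_then_else_)
import Data.Bool as Bool
open import Data.Fin using (Fin; toℕ)
import Data.Fin as Fin
open import Data.Fin.Subset using (Subset; _∈_; _⊆_; _⊂_; Nonempty; ∣_∣; outside)
open import Data.Vec using (Vec; []; _∷_; _[_]≔_)
open import Data.Vec.Properties using (≡-dec)
open import Data.List using (List; []; _∷_; map; concatMap)
open import Data.List.Relation.Unary.All using (All)
open import Data.Product using (Σ; ∃; _×_; _,_)
open import Function.Definitions using (Injective)
open import Function.Bundles using (_⇔_)
open import Relation.Binary.PropositionalEquality using (_≡_; _≢_)
open import Relation.Nullary using (¬_; does)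
open import Data.Sum using (_⊎_)

record SimplicialComplex (n : ℕ) : Set₁ where
  field
    simplex     : Subset n → Set
    nonempty    : ∀ {σ} → simplex σ → Nonempty σ
    down-closed : ∀ {σ τ} → simplex σ → Nonempty τ → τ ⊆ σ → simplex τ
open SimplicialComplex public

_≤ₛ_ : ∀ {n} → SimplicialComplex n → SimplicialComplex n → Set
L ≤ₛ K = ∀ {σ} → simplex L σ → simplex K σ

IsMaximalSimplex : ∀ {n} → SimplicialComplex n → Subset n → Set
IsMaximalSimplex K σ = simplex K σ × (∀ τ → simplex K τ → ¬ (σ ⊂ τ))

-- Cross-polytopal complexes.  Labels v_1..v_{2d} are indexed by Fin (2d)
-- (0-based): v i and v j (i ≠ j) adjacent iff |i - j| ≠ d.

Adjacent : (d : ℕ) → Fin (d + d) → Fin (d + d) → Set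
Adjacent d i j = ∣ toℕ i - toℕ j ∣ ≢ d

Antipodal : (d : ℕ) → Fin (d + d) → Fin (d + d) → Set
Antipodal d i j = ∣ toℕ i - toℕ j ∣ ≡ d

-- simplices of the clique complex of the graph above, transported along v
CliqueSimplex : ∀ {n} (d : ℕ) → (Fin (d + d) → Fin n) → Subset n → Set
CliqueSimplex d v σ =
  Nonempty σ
  × (∀ x → x ∈ σ → ∃ λ i → v i ≡ x)
  × (∀ i j → i ≢ j → v i ∈ σ → v j ∈ σ → Adjacent d i j)

IsCrossPolytopalLabelling : ∀ {n} → SimplicialComplex n → (d : ℕ)
  → (Fin (d + d) → Fin n) → Set
IsCrossPolytopalLabelling L d v =
  Injective _≡_ _≡_ v × (∀ σ → simplex L σ ⇔ CliqueSimplex d v σ)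

AntipodeFree : ∀ {n} (d : ℕ) → (Fin (d + d) → Fin n) → Subset n → Set
AntipodeFree d v σ = ∀ i j → Antipodal d i j → v i ∈ σ → v j ∈ σ → ⊥'
  where open import Data.Empty renaming (⊥ to ⊥')

IsMaximalAntipodeFree : ∀ {n} → SimplicialComplex n → (d : ℕ)
  → (Fin (d + d) → Fin n) → Subset n → Set
IsMaximalAntipodeFree L d v σ =
  simplex L σ × AntipodeFree d v σ
  × (∀ τ → simplex L τ → AntipodeFree d v τ → ¬ (σ ⊂ τ))

-- Simplicial chains with integer coefficients.
-- A simplex σ is oriented by the increasing order of its vertices.
-- A chain is a formal sum, represented as a list of (coefficient, simplex).

Chain : ℕ → Set
Chain n = List (ℤ × Subset n)

elements : ∀ {n} → Subset n → List (Fin n)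
elements []          = []
elements (true ∷ p)  = Fin.zero ∷ map Fin.suc (elements p)
elements (false ∷ p) = map Fin.suc (elements p)

sign : ℕ → ℤ
sign zero    = 1ℤ
sign (suc i) = - sign i

facesFrom : ∀ {n} → ℕ → Subset n → List (Fin n) → Chain n
facesFrom i σ []       = []
facesFrom i σ (x ∷ xs) = (sign i , σ [ x ]≔ outside) ∷ facesFrom (suc i) σ xs

boundarySimplex : ∀ {n} → Subset n → Chain n
boundarySimplex σ = facesFrom 0 σ (elements σ)

scale : ∀ {n} → ℤ → Chain n → Chain n
scale z = map (λ { (a , τ) → (z ℤ.* a , τ) })

∂ : ∀ {n} → Chain n → Chain n
∂ = concatMap (λ { (z , σ) → scale z (boundarySimplex σ) })

coeff : ∀ {n} → Chain n → Subset n → ℤ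
coeff []            τ = 0ℤ
coeff ((z , σ) ∷ c) τ =
  (if does (≡-dec Bool._≟_ σ τ) then z else 0ℤ) ℤ.+ coeff c τ

_≈ᶜ_ : ∀ {n} → Chain n → Chain n → Set
c ≈ᶜ c' = ∀ τ → coeff c τ ≡ coeff c' τ

-- c is a chain of K all of whose simplices have s vertices
-- (i.e. an (s-1)-chain of K)
IsChain : ∀ {n} → SimplicialComplex n → ℕ → Chain n → Set
IsChain K s c = All (λ { (z , σ) → simplex K σ × ∣ σ ∣ ≡ s }) c

IsCycle : ∀ {n} → Chain n → Set
IsCycle c = ∂ c ≈ᶜ []

IsBoundaryIn : ∀ {n} → SimplicialComplex n → ℕ → Chain n → Set
IsBoundaryIn K s c = ∃ λ b → IsChain K (suc s) b × ∂ b ≈ᶜ c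

{-# OPTIONS --safe #-}
module Submission where

-- The (d−1)-simplices of L are its facets F ε, ε ∈ {0,1}ᵈ, each choosing one vertex from every
-- antipodal pair. Deleting the k-th vertex of F ε gives a ridge that lies in exactly two facets,
-- F ε and F ε′ with ε′ = ε flipped at k, with incidence ±1 in each. So at every ridge the cycle
-- condition makes the coefficients of a (d−1)-cycle of L on two adjacent facets vanish together,
-- and as the cube {0,1}ᵈ is connected, a cycle vanishing on one facet is zero. The maximal
-- antipode-free simplex σ₀ is a facet, and being maximal in K it is a face of no simplex of K, so
-- every boundary in K has coefficient 0 on σ₀: a cycle of L that bounds in K is zero. Conversely,
-- the facets signed by the orientation of the cross-polytope form a cycle with coefficient ±1 on
-- σ₀, which therefore does not bound in K.

open import Defs
open import Algebra.Bundles using (CommutativeMonoid; CommutativeRing)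
import Algebra.Properties.CommutativeSemigroup as CommutativeSemigroupProperties
import Algebra.Solver.CommutativeMonoid as CommutativeMonoidSolver
open import Data.Bool as Bool using (Bool; true; false; not; _∧_; _xor_; if_then_else_)
import Data.Bool.Properties as Bool
open import Data.Empty using (⊥; ⊥-elim)
open import Data.Fin as Fin using (Fin; toℕ)
import Data.Fin.Properties as Fin
open import Data.Fin.Subset using (Subset; _∈_; _∉_; _⊆_; _⊂_; ∣_∣; inside; outside; Nonempty)
open import Data.Fin.Subset.Properties using (_∈?_; ∉⊥; ⊆-antisym; p⊂q⇒∣p∣<∣q∣; ∣⊥∣≡0)
import Data.Fin.Subset as Subset
open import Data.Integer as ℤ using (ℤ; 0ℤ; 1ℤ; -1ℤ; -_)
import Data.Integer.Properties as ℤ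
open import Data.Integer.Tactic.RingSolver using (solve-∀)
open import Data.List as List using (List; []; _∷_; _++_)
open import Data.List.Relation.Unary.All as All using (All; []; _∷_)
import Data.List.Relation.Unary.All.Properties as All
open import Data.List.Relation.Unary.Any using (Any; here; there)
open import Data.List.Membership.Propositional using () renaming (_∈_ to _∈ˡ_)
import Data.List.Membership.Propositional.Properties as List
open import Data.Nat as ℕ using (ℕ; zero; suc; _+_; _∸_; _≤_; _<_; _<ᵇ_; ∣_-_∣)
import Data.Nat.Properties as ℕ
open import Data.Product using (∃; ∃₂; _×_; _,_; proj₁; proj₂; map₁)
open import Data.Sum using (_⊎_; inj₁; inj₂; [_,_]′)
open import Data.Vec as Vec using (Vec; []; _∷_; lookup; _[_]≔_; _[_]%=_)
import Data.Vec.Properties as Vec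
open import Function using (_∘_)
open import Function.Bundles using (mk⇔; Equivalence)
open import Function.Definitions using (Injective)
open import Relation.Binary.PropositionalEquality
open import Relation.Nullary using (¬_; yes; no; does)
open import Relation.Nullary.Decidable using (dec-true; dec-false; does-⇔; decidable-stable)

private
  variable
    m n : ℕ

-- Subsets

module _ {p : Subset n} {x : Fin n} where

  x∈p[x]≔inside : x ∈ p [ x ]≔ inside
  x∈p[x]≔inside = Vec.[]≔-updates p x

  x∉p[x]≔outside : x ∉ p [ x ]≔ outside
  x∉p[x]≔outside x∈ with Vec.[]=-injective x∈ (Vec.[]≔-updates p x)
  ... | ()

  ∈-[]≔⁻ : ∀ {y b} → y ≢ x → y ∈ p [ x ]≔ b → y ∈ p
  ∈-[]≔⁻ {y} {b} y≢x y∈ =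
    Vec.lookup⇒[]= y p (trans (sym (Vec.lookup∘update′ y≢x p b)) (Vec.[]=⇒lookup y∈))

  ∈-[]≔⁺ : ∀ {y b} → y ≢ x → y ∈ p → y ∈ p [ x ]≔ b
  ∈-[]≔⁺ y≢x = Vec.[]≔-minimal p _ x y≢x

  insert-remove : x ∈ p → (p [ x ]≔ outside) [ x ]≔ inside ≡ p
  insert-remove x∈p = begin
    (p [ x ]≔ outside) [ x ]≔ inside ≡⟨ Vec.[]≔-idempotent p x ⟩
    p [ x ]≔ inside                  ≡⟨ cong (p [ x ]≔_) (sym (Vec.[]=⇒lookup x∈p)) ⟩
    p [ x ]≔ lookup p x              ≡⟨ Vec.[]≔-lookup p x ⟩
    p                                ∎
    where open ≡-Reasoning


[]≔outside-⊆ : ∀ {p : Subset n} {x} → p [ x ]≔ outside ⊆ p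
[]≔outside-⊆ {x = x} {y} y∈ with y Fin.≟ x
... | yes refl = ⊥-elim (x∉p[x]≔outside y∈)
... | no  y≢x  = ∈-[]≔⁻ y≢x y∈

[]≔outside-⊂ : ∀ {p : Subset n} {x} → x ∈ p → p [ x ]≔ outside ⊂ p
[]≔outside-⊂ {x = x} x∈p = []≔outside-⊆ , x , x∈p , x∉p[x]≔outside

[]≔outside-injective : ∀ {p : Subset n} {x y} → x ∈ p → p [ y ]≔ outside ≡ p [ x ]≔ outside → y ≡ x
[]≔outside-injective {x = x} {y} x∈p eq with y Fin.≟ x
... | yes y≡x = y≡x
... | no  y≢x = ⊥-elim (x∉p[x]≔outside (subst (x ∈_) eq (∈-[]≔⁺ (y≢x ∘ sym) x∈p)))

∣p[x]≔inside∣ : ∀ (p : Subset n) x → x ∉ p → ∣ p [ x ]≔ inside ∣ ≡ suc ∣ p ∣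
∣p[x]≔inside∣ (false ∷ p) Fin.zero    _   = refl
∣p[x]≔inside∣ (true  ∷ p) Fin.zero    x∉p = ⊥-elim (x∉p Vec.here)
∣p[x]≔inside∣ (false ∷ p) (Fin.suc x) x∉p = ∣p[x]≔inside∣ p x (x∉p ∘ Vec.there)
∣p[x]≔inside∣ (true  ∷ p) (Fin.suc x) x∉p = cong suc (∣p[x]≔inside∣ p x (x∉p ∘ Vec.there))

⊆∧¬⊂⇒≡ : {p q : Subset n} → p ⊆ q → ¬ p ⊂ q → p ≡ q
⊆∧¬⊂⇒≡ {p = p} {q} p⊆q p⊄q = ⊆-antisym p⊆q q⊆p
  where
  q⊆p : q ⊆ p
  q⊆p {x} x∈q with x ∈? p
  ... | yes x∈p = x∈p
  ... | no  x∉p = ⊥-elim (p⊄q (p⊆q , x , x∈q , x∉p))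

⊆∧∣≡∣⇒≡ : {p q : Subset n} → p ⊆ q → ∣ p ∣ ≡ ∣ q ∣ → p ≡ q
⊆∧∣≡∣⇒≡ p⊆q ∣p∣≡∣q∣ = ⊆∧¬⊂⇒≡ p⊆q (ℕ.<-irrefl ∣p∣≡∣q∣ ∘ p⊂q⇒∣p∣<∣q∣)

image : (Fin m → Fin n) → Subset n
image {zero}  f = Subset.⊥
image {suc m} f = image (f ∘ Fin.suc) [ f Fin.zero ]≔ inside

∈-image⁺ : (f : Fin m → Fin n) (k : Fin m) → f k ∈ image f
∈-image⁺ f Fin.zero    = x∈p[x]≔inside
∈-image⁺ f (Fin.suc k) with f Fin.zero Fin.≟ f (Fin.suc k)
... | yes f0≡fk = subst (_∈ image f) f0≡fk x∈p[x]≔inside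
... | no  f0≢fk = ∈-[]≔⁺ (f0≢fk ∘ sym) (∈-image⁺ (f ∘ Fin.suc) k)

∈-image⁻ : (f : Fin m → Fin n) {x : Fin n} → x ∈ image f → ∃ λ k → f k ≡ x
∈-image⁻ {zero}  f x∈ = ⊥-elim (∉⊥ x∈)
∈-image⁻ {suc m} f {x} x∈ with x Fin.≟ f Fin.zero
... | yes x≡f0 = Fin.zero , sym x≡f0
... | no  x≢f0 with ∈-image⁻ (f ∘ Fin.suc) (∈-[]≔⁻ x≢f0 x∈)
...   | k , fk≡x = Fin.suc k , fk≡x

∣image∣ : {f : Fin m → Fin n} → Injective _≡_ _≡_ f → ∣ image f ∣ ≡ m
∣image∣ {zero} {n} _   = ∣⊥∣≡0 n
∣image∣ {suc m} {f = f} inj =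
  trans (∣p[x]≔inside∣ _ _ f0∉) (cong suc (∣image∣ (Fin.suc-injective ∘ inj)))
  where
  f0∉ : f Fin.zero ∉ image (f ∘ Fin.suc)
  f0∉ f0∈ with ∈-image⁻ (f ∘ Fin.suc) f0∈
  ... | k , fk≡f0 with inj fk≡f0
  ...   | ()

-- Parity and signs

xor-commutativeMonoid : CommutativeMonoid _ _
xor-commutativeMonoid = CommutativeRing.+-commutativeMonoid Bool.xor-∧-commutativeRing

parity : (Fin n → Bool) → Subset n → Bool
parity f []      = false
parity f (b ∷ p) = (b ∧ f Fin.zero) xor parity (f ∘ Fin.suc) p

open CommutativeSemigroupProperties (CommutativeMonoid.commutativeSemigroup xor-commutativeMonoid)
  using (x∙yz≈y∙xz; interchange)

parity-insert : ∀ (f : Fin n → Bool) {p x} → x ∉ p → parity f (p [ x ]≔ inside) ≡ f x xor parity f p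
parity-insert f {p = false ∷ p} {Fin.zero}  _   = refl
parity-insert f {p = true  ∷ p} {Fin.zero}  x∉p = ⊥-elim (x∉p Vec.here)
parity-insert f {p = b ∷ p}     {Fin.suc x} x∉p =
  trans (cong ((b ∧ f Fin.zero) xor_) (parity-insert (f ∘ Fin.suc) (x∉p ∘ Vec.there)))
        (x∙yz≈y∙xz (b ∧ f Fin.zero) (f (Fin.suc x)) _)

parity-xor : ∀ (f g : Fin n → Bool) p →
             parity (λ x → f x xor g x) p ≡ parity f p xor parity g p
parity-xor f g []      = refl
parity-xor f g (b ∷ p) =
  trans (cong₂ _xor_ (Bool.∧-distribˡ-xor b (f Fin.zero) (g Fin.zero))
                     (parity-xor (f ∘ Fin.suc) (g ∘ Fin.suc) p))
        (interchange (b ∧ f Fin.zero) (b ∧ g Fin.zero) _ _)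

parity-cong : ∀ {f g : Fin n → Bool} p → (∀ {x} → x ∈ p → f x ≡ g x) → parity f p ≡ parity g p
parity-cong []          _   = refl
parity-cong (false ∷ p) f≗g = parity-cong p (f≗g ∘ Vec.there)
parity-cong (true  ∷ p) f≗g = cong₂ _xor_ (f≗g Vec.here) (parity-cong p (f≗g ∘ Vec.there))

parity-false : ∀ (p : Subset n) → parity (λ _ → false) p ≡ false
parity-false []      = refl
parity-false (b ∷ p) = trans (cong (_xor parity (λ _ → false) p) (Bool.∧-zeroʳ b)) (parity-false p)

<ᵇ-irrefl : ∀ m → (m <ᵇ m) ≡ false
<ᵇ-irrefl zero    = refl
<ᵇ-irrefl (suc m) = <ᵇ-irrefl m

<ᵇ-flip : ∀ {m n} → m ≢ n → (n <ᵇ m) ≡ not (m <ᵇ n)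
<ᵇ-flip {zero}  {zero}  m≢n = ⊥-elim (m≢n refl)
<ᵇ-flip {zero}  {suc n} _   = refl
<ᵇ-flip {suc m} {zero}  _   = refl
<ᵇ-flip {suc m} {suc n} m≢n = <ᵇ-flip (m≢n ∘ cong suc)

sgn : Bool → ℤ
sgn false = 1ℤ
sgn true  = -1ℤ

sgn-xor : ∀ a b → sgn (a xor b) ≡ sgn a ℤ.* sgn b
sgn-xor false false = refl
sgn-xor false true  = refl
sgn-xor true  false = refl
sgn-xor true  true  = refl

sgn-not : ∀ b → sgn (not b) ≡ - sgn b
sgn-not false = refl
sgn-not true  = refl

sgn≢0 : ∀ b → sgn b ≢ 0ℤ
sgn≢0 false ()
sgn≢0 true  ()

*sgn≡0⇒≡0 : ∀ x b → x ℤ.* sgn b ≡ 0ℤ → x ≡ 0ℤ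
*sgn≡0⇒≡0 x b x*s≡0 with ℤ.i*j≡0⇒i≡0∨j≡0 x x*s≡0
... | inj₁ x≡0 = x≡0
... | inj₂ s≡0 = ⊥-elim (sgn≢0 b s≡0)

-- Chains and boundaries

incidence : Subset n → Subset n → ℤ
incidence σ ρ = coeff (boundarySimplex σ) ρ

evaluate : Chain n → (Subset n → ℤ) → ℤ
evaluate []            g = 0ℤ
evaluate ((z , σ) ∷ c) g = z ℤ.* g σ ℤ.+ evaluate c g

coeff-++ : ∀ (c c′ : Chain n) τ → coeff (c ++ c′) τ ≡ coeff c τ ℤ.+ coeff c′ τ
coeff-++ []            c′ τ = sym (ℤ.+-identityˡ _)
coeff-++ ((z , σ) ∷ c) c′ τ = trans (cong (λ t → e ℤ.+ t) (coeff-++ c c′ τ)) (sym (ℤ.+-assoc e _ _))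
  where e = if does (Vec.≡-dec Bool._≟_ σ τ) then z else 0ℤ

coeff-scale : ∀ a (c : Chain n) τ → coeff (scale a c) τ ≡ a ℤ.* coeff c τ
coeff-scale a []            τ = sym (ℤ.*-zeroʳ a)
coeff-scale a ((z , σ) ∷ c) τ with does (Vec.≡-dec Bool._≟_ σ τ)
... | true  = trans (cong (λ t → a ℤ.* z ℤ.+ t) (coeff-scale a c τ)) (sym (ℤ.*-distribˡ-+ a z (coeff c τ)))
... | false = trans (ℤ.+-identityˡ _)
                    (trans (coeff-scale a c τ) (cong (a ℤ.*_) (sym (ℤ.+-identityˡ (coeff c τ)))))

coeff-∂ : ∀ (c : Chain n) ρ → coeff (∂ c) ρ ≡ evaluate c (λ σ → incidence σ ρ)
coeff-∂ []            ρ = refl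
coeff-∂ ((z , σ) ∷ c) ρ =
  trans (coeff-++ (scale z (boundarySimplex σ)) (∂ c) ρ)
        (cong₂ ℤ._+_ (coeff-scale z (boundarySimplex σ) ρ) (coeff-∂ c ρ))

coeff≢0⇒Any : ∀ (c : Chain n) {τ} → coeff c τ ≢ 0ℤ → Any ((_≡ τ) ∘ proj₂) c
coeff≢0⇒Any []            c≢0 = ⊥-elim (c≢0 refl)
coeff≢0⇒Any ((z , σ) ∷ c) {τ} c≢0 with Vec.≡-dec Bool._≟_ σ τ
... | yes σ≡τ = here σ≡τ
... | no  _   = there (coeff≢0⇒Any c (c≢0 ∘ trans (ℤ.+-identityˡ _)))

evaluate≢0⇒Any : ∀ (c : Chain n) {g} → evaluate c g ≢ 0ℤ → Any ((_≢ 0ℤ) ∘ g ∘ proj₂) c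
evaluate≢0⇒Any []            e≢0 = ⊥-elim (e≢0 refl)
evaluate≢0⇒Any ((z , σ) ∷ c) {g} e≢0 with g σ ℤ.≟ 0ℤ
... | no  gσ≢0 = here gσ≢0
... | yes gσ≡0 = there (evaluate≢0⇒Any c λ e≡0 →
  e≢0 (trans (cong₂ ℤ._+_ (trans (cong (z ℤ.*_) gσ≡0) (ℤ.*-zeroʳ z)) e≡0) refl))

private
  collect-terms : ∀ {h t} eA eB cA cB gA gB →
            h ≡ eA ℤ.* gA ℤ.+ eB ℤ.* gB → t ≡ cA ℤ.* gA ℤ.+ cB ℤ.* gB →
            h ℤ.+ t ≡ (eA ℤ.+ cA) ℤ.* gA ℤ.+ (eB ℤ.+ cB) ℤ.* gB
  collect-terms eA eB cA cB gA gB refl refl = ring eA eB cA cB gA gB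
    where
    ring : ∀ eA eB cA cB gA gB → eA ℤ.* gA ℤ.+ eB ℤ.* gB ℤ.+ (cA ℤ.* gA ℤ.+ cB ℤ.* gB)
                               ≡ (eA ℤ.+ cA) ℤ.* gA ℤ.+ (eB ℤ.+ cB) ℤ.* gB
    ring = solve-∀

evaluate-two : ∀ (c : Chain n) {g : Subset n → ℤ} {A B} → A ≢ B →
               All (λ (_ , σ) → σ ≢ A → σ ≢ B → g σ ≡ 0ℤ) c →
               evaluate c g ≡ coeff c A ℤ.* g A ℤ.+ coeff c B ℤ.* g B
evaluate-two []                _   _ = refl
evaluate-two ((z , σ) ∷ c) {g} {A} {B} A≢B (off ∷ rest)
  with evaluate-two c A≢B rest | Vec.≡-dec Bool._≟_ σ A | Vec.≡-dec Bool._≟_ σ B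
... | ih | yes refl | yes refl = ⊥-elim (A≢B refl)
... | ih | yes refl | no  _    =
  collect-terms z 0ℤ (coeff c A) (coeff c B) (g A) (g B) (sym (ℤ.+-identityʳ (z ℤ.* g A))) ih
... | ih | no  _    | yes refl =
  collect-terms 0ℤ z (coeff c A) (coeff c B) (g A) (g B) (sym (ℤ.+-identityˡ (z ℤ.* g B))) ih
... | ih | no  σ≢A  | no  σ≢B  =
  collect-terms 0ℤ 0ℤ (coeff c A) (coeff c B) (g A) (g B) (trans (cong (z ℤ.*_) (off σ≢A σ≢B)) (ℤ.*-zeroʳ z)) ih

facePosition : Subset n → Fin n → Bool
facePosition σ a = parity (λ x → toℕ x <ᵇ toℕ a) σ

signedPosition : ℕ → List (Fin n) → Fin n → ℤ
signedPosition i []       a = 0ℤ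
signedPosition i (x ∷ xs) a =
  (if does (x Fin.≟ a) then sign i else 0ℤ) ℤ.+ signedPosition (suc i) xs a

signedPosition-suc-zero : ∀ i (xs : List (Fin n)) → signedPosition i (List.map Fin.suc xs) Fin.zero ≡ 0ℤ
signedPosition-suc-zero i []       = refl
signedPosition-suc-zero i (x ∷ xs) = trans (ℤ.+-identityˡ _) (signedPosition-suc-zero (suc i) xs)

signedPosition-suc-suc : ∀ i (xs : List (Fin n)) a →
  signedPosition i (List.map Fin.suc xs) (Fin.suc a) ≡ signedPosition i xs a
signedPosition-suc-suc i []       a = refl
signedPosition-suc-suc i (x ∷ xs) a =
  cong (λ t → (if does (x Fin.≟ a) then sign i else 0ℤ) ℤ.+ t) (signedPosition-suc-suc (suc i) xs a)

signedPosition-elements : ∀ i (σ : Subset n) {a} → a ∈ σ →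
  signedPosition i (elements σ) a ≡ sign i ℤ.* sgn (facePosition σ a)
signedPosition-elements i (true ∷ σ) {Fin.zero} _ = begin
  sign i ℤ.+ signedPosition (suc i) (List.map Fin.suc (elements σ)) Fin.zero
    ≡⟨ cong (λ t → sign i ℤ.+ t) (signedPosition-suc-zero (suc i) (elements σ)) ⟩
  sign i ℤ.+ 0ℤ
    ≡⟨ ℤ.+-identityʳ (sign i) ⟩
  sign i
    ≡⟨ sym (ℤ.*-identityʳ (sign i)) ⟩
  sign i ℤ.* sgn false
    ≡⟨ cong (λ b → sign i ℤ.* sgn b) (sym (parity-false σ)) ⟩
  sign i ℤ.* sgn (parity (λ _ → false) σ)
    ∎
  where open ≡-Reasoning
signedPosition-elements i (true ∷ σ) {Fin.suc a} (Vec.there a∈σ) = begin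
  0ℤ ℤ.+ signedPosition (suc i) (List.map Fin.suc (elements σ)) (Fin.suc a)
    ≡⟨ ℤ.+-identityˡ _ ⟩
  signedPosition (suc i) (List.map Fin.suc (elements σ)) (Fin.suc a)
    ≡⟨ signedPosition-suc-suc (suc i) (elements σ) a ⟩
  signedPosition (suc i) (elements σ) a
    ≡⟨ signedPosition-elements (suc i) σ a∈σ ⟩
  - sign i ℤ.* sgn P
    ≡⟨ sym (ℤ.neg-distribˡ-* (sign i) (sgn P)) ⟩
  - (sign i ℤ.* sgn P)
    ≡⟨ ℤ.neg-distribʳ-* (sign i) (sgn P) ⟩
  sign i ℤ.* - sgn P
    ≡⟨ cong (sign i ℤ.*_) (sym (sgn-not P)) ⟩
  sign i ℤ.* sgn (not P)
    ∎
  where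
  open ≡-Reasoning
  P = facePosition σ a
signedPosition-elements i (false ∷ σ) {Fin.suc a} (Vec.there a∈σ) =
  trans (signedPosition-suc-suc i (elements σ) a) (signedPosition-elements i σ a∈σ)

∈-elements⁻ : ∀ (σ : Subset n) {x} → x ∈ˡ elements σ → x ∈ σ
∈-elements⁻ (true ∷ σ)  (here refl) = Vec.here
∈-elements⁻ (true ∷ σ)  (there x∈) with List.∈-map⁻ Fin.suc x∈
... | y , y∈ , refl = Vec.there (∈-elements⁻ σ y∈)
∈-elements⁻ (false ∷ σ) x∈ with List.∈-map⁻ Fin.suc x∈
... | y , y∈ , refl = Vec.there (∈-elements⁻ σ y∈)

coeff-facesFrom : ∀ i {σ : Subset n} {a} → a ∈ σ → ∀ xs →
  coeff (facesFrom i σ xs) (σ [ a ]≔ outside) ≡ signedPosition i xs a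
coeff-facesFrom i             a∈σ []       = refl
coeff-facesFrom i {σ} {a} a∈σ (x ∷ xs) =
  cong₂ ℤ._+_ (cong (λ b → if b then sign i else 0ℤ) same-face)
              (coeff-facesFrom (suc i) a∈σ xs)
  where
  same-face : does (Vec.≡-dec Bool._≟_ (σ [ x ]≔ outside) (σ [ a ]≔ outside)) ≡ does (x Fin.≟ a)
  same-face = does-⇔ (mk⇔ ([]≔outside-injective a∈σ) (cong (σ [_]≔ outside)))
                      (Vec.≡-dec Bool._≟_ (σ [ x ]≔ outside) (σ [ a ]≔ outside)) (x Fin.≟ a)

coeff-facesFrom≢0 : ∀ i (σ : Subset n) xs {ρ} → coeff (facesFrom i σ xs) ρ ≢ 0ℤ →
  ∃ λ x → x ∈ˡ xs × σ [ x ]≔ outside ≡ ρ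
coeff-facesFrom≢0 i σ []       c≢0 = ⊥-elim (c≢0 refl)
coeff-facesFrom≢0 i σ (x ∷ xs) {ρ} c≢0 with Vec.≡-dec Bool._≟_ (σ [ x ]≔ outside) ρ
... | yes face≡ρ = x , here refl , face≡ρ
... | no  _ with coeff-facesFrom≢0 (suc i) σ xs (c≢0 ∘ trans (ℤ.+-identityˡ _))
...   | y , y∈ , face≡ρ = y , there y∈ , face≡ρ

incidence-face : ∀ {σ : Subset n} {a} → a ∈ σ →
  incidence σ (σ [ a ]≔ outside) ≡ sgn (facePosition σ a)
incidence-face {σ = σ} a∈σ =
  trans (coeff-facesFrom 0 a∈σ (elements σ))
        (trans (signedPosition-elements 0 σ a∈σ) (ℤ.*-identityˡ _))

incidence≢0⇒face : ∀ σ {ρ : Subset n} → incidence σ ρ ≢ 0ℤ → ∃ λ x → x ∈ σ × σ [ x ]≔ outside ≡ ρ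
incidence≢0⇒face σ i≢0 with coeff-facesFrom≢0 0 σ (elements σ) i≢0
... | x , x∈ , face≡ρ = x , ∈-elements⁻ σ x∈ , face≡ρ

facePosition-insert : ∀ {ρ : Subset n} {a} → a ∉ ρ → facePosition (ρ [ a ]≔ inside) a ≡ facePosition ρ a
facePosition-insert {ρ = ρ} {a} a∉ρ =
  trans (parity-insert (λ x → toℕ x <ᵇ toℕ a) a∉ρ) (cong (_xor facePosition ρ a) (<ᵇ-irrefl (toℕ a)))

coeff-boundary-maximal : ∀ {K : SimplicialComplex n} {σ s c} →
  IsMaximalSimplex K σ → IsBoundaryIn K s c → coeff c σ ≡ 0ℤ
coeff-boundary-maximal {n} {K} {σ} {s} (_ , maximal) (b , b∈K , ∂b≈c) =
  trans (sym (∂b≈c σ))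
        (trans (coeff-∂ b σ) (decidable-stable (evaluate b (λ τ → incidence τ σ) ℤ.≟ 0ℤ) no-coface))
  where
  not-coface : ∀ {e : ℤ × Subset n} → simplex K (proj₂ e) × ∣ proj₂ e ∣ ≡ suc s →
               incidence (proj₂ e) σ ≢ 0ℤ → ⊥
  not-coface {_ , τ} (τ∈K , _) i≢0 with incidence≢0⇒face τ i≢0
  ... | x , x∈τ , face≡σ = maximal τ τ∈K (subst (_⊂ τ) face≡σ ([]≔outside-⊂ x∈τ))

  no-coface : ¬ evaluate b (λ τ → incidence τ σ) ≢ 0ℤ
  no-coface e≢0 = All.lookupWith (λ {e} → not-coface {e}) b∈K (evaluate≢0⇒Any b e≢0)

-- The cube {0,1}ᵈ

lookup-ext : ∀ {A : Set} {u w : Vec A m} → (∀ k → lookup u k ≡ lookup w k) → u ≡ w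
lookup-ext {u = u} {w} u≗w =
  trans (sym (Vec.tabulate∘lookup u)) (trans (Vec.tabulate-cong u≗w) (Vec.tabulate∘lookup w))

flip : Vec Bool m → Fin m → Vec Bool m
flip ε i = ε [ i ]%= not

module _ (ε : Vec Bool m) (i : Fin m) where

  lookup-flip : lookup (flip ε i) i ≡ not (lookup ε i)
  lookup-flip = Vec.lookup∘updateAt i ε

  lookup-flip′ : ∀ {k} → k ≢ i → lookup (flip ε i) k ≡ lookup ε k
  lookup-flip′ {k} k≢i = Vec.lookup∘updateAt′ k i k≢i ε

  flip≢ : flip ε i ≢ ε
  flip≢ flip≡ε = Bool.not-¬ refl (trans (sym (cong (λ η → lookup η i) flip≡ε)) lookup-flip)

  ≡-or-flip : ∀ {ε′} → (∀ {k} → k ≢ i → lookup ε k ≡ lookup ε′ k) → ε′ ≡ ε ⊎ ε′ ≡ flip ε i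
  ≡-or-flip {ε′} agree with lookup ε′ i Bool.≟ lookup ε i
  ... | yes same = inj₁ (lookup-ext pointwise)
    where
    pointwise : ∀ k → lookup ε′ k ≡ lookup ε k
    pointwise k with k Fin.≟ i
    ... | yes refl = same
    ... | no  k≢i  = sym (agree k≢i)
  ... | no  differ = inj₂ (lookup-ext pointwise)
    where
    pointwise : ∀ k → lookup ε′ k ≡ lookup (flip ε i) k
    pointwise k with k Fin.≟ i
    ... | yes refl = trans (Bool.¬-not differ) (sym lookup-flip)
    ... | no  k≢i  = trans (sym (agree k≢i)) (sym (lookup-flip′ k≢i))

cube-induction : ∀ (P : Vec Bool m → Set) → (∀ ε i → P ε → P (flip ε i)) → ∀ ε₀ → P ε₀ → ∀ ε → P ε
cube-induction P step []       P[] []      = P[]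
cube-induction P step (b₀ ∷ η₀) Pε₀ (b ∷ η) =
  fix-head b₀ b (cube-induction (P ∘ (b₀ ∷_)) (λ η i → step (b₀ ∷ η) (Fin.suc i)) η₀ Pε₀ η)
  where
  fix-head : ∀ b₀ b → P (b₀ ∷ η) → P (b ∷ η)
  fix-head false false = λ p → p
  fix-head true  true  = λ p → p
  fix-head false true  = step (false ∷ η) Fin.zero
  fix-head true  false = step (true ∷ η) Fin.zero

cubeChain : ∀ m → (Vec Bool m → ℤ) → (Vec Bool m → Subset n) → Chain n
cubeChain zero    c S = (c [] , S []) ∷ []
cubeChain (suc m) c S =
  cubeChain m (c ∘ (true ∷_)) (S ∘ (true ∷_)) ++ cubeChain m (c ∘ (false ∷_)) (S ∘ (false ∷_))

All-cubeChain : ∀ {P : ℤ × Subset n → Set} m {c S} → (∀ ε → P (c ε , S ε)) → All P (cubeChain m c S)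
All-cubeChain zero    P[c,S] = P[c,S] [] ∷ []
All-cubeChain (suc m) P[c,S] =
  All.++⁺ (All-cubeChain m (P[c,S] ∘ (true ∷_))) (All-cubeChain m (P[c,S] ∘ (false ∷_)))

coeff-cubeChain-∉ : ∀ m {c} {S : Vec Bool m → Subset n} {τ} → (∀ ε → S ε ≢ τ) →
                    coeff (cubeChain m c S) τ ≡ 0ℤ
coeff-cubeChain-∉ zero {S = S} {τ} S≢τ with Vec.≡-dec Bool._≟_ (S []) τ
... | yes S≡τ = ⊥-elim (S≢τ [] S≡τ)
... | no  _   = refl
coeff-cubeChain-∉ (suc m) {c} {S} {τ} S≢τ =
  trans (coeff-++ (cubeChain m _ _) (cubeChain m _ _) τ)
        (cong₂ ℤ._+_ (coeff-cubeChain-∉ m (S≢τ ∘ (true ∷_)))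
                     (coeff-cubeChain-∉ m (S≢τ ∘ (false ∷_))))

coeff-cubeChain : ∀ m {c} {S : Vec Bool m → Subset n} → Injective _≡_ _≡_ S → ∀ ε →
                  coeff (cubeChain m c S) (S ε) ≡ c ε
coeff-cubeChain zero {c} {S} _ [] with Vec.≡-dec Bool._≟_ (S []) (S [])
... | yes _   = ℤ.+-identityʳ (c [])
... | no  S≢S = ⊥-elim (S≢S refl)
coeff-cubeChain (suc m) {c} {S} S-inj (true ∷ ε) =
  trans (coeff-++ (cubeChain m _ _) (cubeChain m _ _) (S (true ∷ ε)))
        (trans (cong₂ ℤ._+_ (coeff-cubeChain m (Vec.∷-injectiveʳ ∘ S-inj) ε)
                            (coeff-cubeChain-∉ m (λ η → heads-differ ∘ S-inj)))
               (ℤ.+-identityʳ _))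
  where heads-differ : ∀ {η} → false ∷ η ≢ true ∷ ε
        heads-differ ()
coeff-cubeChain (suc m) {c} {S} S-inj (false ∷ ε) =
  trans (coeff-++ (cubeChain m _ _) (cubeChain m _ _) (S (false ∷ ε)))
        (trans (cong₂ ℤ._+_ (coeff-cubeChain-∉ m (λ η → heads-differ ∘ S-inj))
                            (coeff-cubeChain m (Vec.∷-injectiveʳ ∘ S-inj) ε))
               (ℤ.+-identityˡ _))
  where heads-differ : ∀ {η} → true ∷ η ≢ false ∷ ε
        heads-differ ()

-- Orientation

-- Read pair x as the index of the antipodal pair of the vertex x and side x as its pole. Then
-- orientation S is the sign of the permutation sorting S by pair index, times (-1) for each vertex
-- at a true pole: the coefficient of S in the join (v₁ − v_{1+d}) ∗ ⋯ ∗ (v_d − v_{2d}), the usual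
-- fundamental cycle of the cross-polytope, rewritten in the increasing vertex order used by ∂.
module Orientation (side : Fin n → Bool) (pair : Fin n → ℕ) where

  inverted : Fin n → Fin n → Bool
  inverted x y = (toℕ x <ᵇ toℕ y) ∧ (pair y <ᵇ pair x)

  inversions : Subset n → Bool
  inversions S = parity (λ x → parity (inverted x) S) S

  orientation : Subset n → Bool
  orientation S = parity side S xor inversions S

  inversions-insert : ∀ {ρ a} → a ∉ ρ →
    inversions (ρ [ a ]≔ inside) ≡ parity (inverted a) ρ xor (parity (λ x → inverted x a) ρ xor inversions ρ)
  inversions-insert {ρ} {a} a∉ρ = begin
    parity (λ x → parity (inverted x) S) S
      ≡⟨ parity-insert (λ x → parity (inverted x) S) a∉ρ ⟩
    parity (inverted a) S xor parity (λ x → parity (inverted x) S) ρ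
      ≡⟨ cong₂ _xor_ inverted-a (parity-cong ρ (λ _ → parity-insert (inverted _) a∉ρ)) ⟩
    parity (inverted a) ρ xor parity (λ x → inverted x a xor parity (inverted x) ρ) ρ
      ≡⟨ cong (parity (inverted a) ρ xor_) (parity-xor (λ x → inverted x a) (λ x → parity (inverted x) ρ) ρ) ⟩
    parity (inverted a) ρ xor (parity (λ x → inverted x a) ρ xor inversions ρ)
      ∎
    where
    open ≡-Reasoning
    S = ρ [ a ]≔ inside
    inverted-a : parity (inverted a) S ≡ parity (inverted a) ρ
    inverted-a = trans (parity-insert (inverted a) a∉ρ)
                       (cong (λ b → (b ∧ (pair a <ᵇ pair a)) xor parity (inverted a) ρ) (<ᵇ-irrefl (toℕ a)))

  private
    inverted-either-way : ∀ {x a} → x ≢ a → pair x ≢ pair a →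
      inverted a x xor (inverted x a xor (toℕ x <ᵇ toℕ a)) ≡ (pair x <ᵇ pair a)
    inverted-either-way {x} {a} x≢a px≢pa
      rewrite <ᵇ-flip (x≢a ∘ Fin.toℕ-injective) | <ᵇ-flip px≢pa
      with toℕ x <ᵇ toℕ a | pair x <ᵇ pair a
    ... | false | false = refl
    ... | false | true  = refl
    ... | true  | false = refl
    ... | true  | true  = refl

    open CommutativeMonoidSolver xor-commutativeMonoid using (solve; _⊜_; _⊕_)

    rearrange : ∀ s P I A B F → ((s xor P) xor (A xor (B xor I))) xor F
                              ≡ s xor ((P xor I) xor (A xor (B xor F)))
    rearrange = solve 6 (λ s P I A B F → ((s ⊕ P) ⊕ (A ⊕ (B ⊕ I))) ⊕ F
                                       ⊜ s ⊕ ((P ⊕ I) ⊕ (A ⊕ (B ⊕ F)))) refl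

  -- Everything that depends on where a sits among ρ in the vertex order cancels, so the result
  -- depends on a only through side a and pair a.
  orientation-insert : ∀ {ρ a} → a ∉ ρ → (∀ {x} → x ∈ ρ → pair x ≢ pair a) →
    orientation (ρ [ a ]≔ inside) xor facePosition (ρ [ a ]≔ inside) a
      ≡ side a xor (orientation ρ xor parity (λ x → pair x <ᵇ pair a) ρ)
  orientation-insert {ρ} {a} a∉ρ pairs-differ = begin
    orientation S xor facePosition S a
      ≡⟨ cong₂ _xor_ (cong₂ _xor_ (parity-insert side a∉ρ) (inversions-insert a∉ρ)) (facePosition-insert a∉ρ) ⟩
    ((side a xor parity side ρ) xor (Iₐ xor (Iₓ xor inversions ρ))) xor facePosition ρ a
      ≡⟨ rearrange (side a) (parity side ρ) (inversions ρ) Iₐ Iₓ (facePosition ρ a) ⟩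
    side a xor (orientation ρ xor (Iₐ xor (Iₓ xor facePosition ρ a)))
      ≡⟨ cong (λ t → side a xor (orientation ρ xor t)) (begin
           Iₐ xor (Iₓ xor facePosition ρ a)
             ≡⟨ cong (Iₐ xor_) (sym (parity-xor (λ x → inverted x a) (λ x → toℕ x <ᵇ toℕ a) ρ)) ⟩
           Iₐ xor parity (λ x → inverted x a xor (toℕ x <ᵇ toℕ a)) ρ
             ≡⟨ sym (parity-xor (inverted a) _ ρ) ⟩
           parity (λ x → inverted a x xor (inverted x a xor (toℕ x <ᵇ toℕ a))) ρ
             ≡⟨ parity-cong ρ (λ x∈ρ → inverted-either-way (λ { refl → a∉ρ x∈ρ }) (pairs-differ x∈ρ)) ⟩
           parity (λ x → pair x <ᵇ pair a) ρ
             ∎) ⟩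
    side a xor (orientation ρ xor parity (λ x → pair x <ᵇ pair a) ρ)
      ∎
    where
    open ≡-Reasoning
    S  = ρ [ a ]≔ inside
    Iₐ = parity (inverted a) ρ
    Iₓ = parity (λ x → inverted x a) ρ

-- The cross-polytope

∣m-n∣<d : ∀ {m n d} → m < d → n < d → ∣ m - n ∣ < d
∣m-n∣<d {m} {n} m<d n<d = ℕ.≤-<-trans (ℕ.∣m-n∣≤m⊔n m n) (ℕ.⊔-lub m<d n<d)

∣m-d+n∣≡d⇒m≡n : ∀ {m n d} → m < d → ∣ m - d + n ∣ ≡ d → m ≡ n
∣m-d+n∣≡d⇒m≡n {m} {n} {d} m<d ∣m-d+n∣≡d = ℕ.+-cancelˡ-≡ d m n (begin
  d + m           ≡⟨ cong (_+ m) (sym d+n∸m≡d) ⟩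
  d + n ∸ m + m   ≡⟨ ℕ.m∸n+n≡m m≤d+n ⟩
  d + n           ∎)
  where
  open ≡-Reasoning
  m≤d+n : m ≤ d + n
  m≤d+n = ℕ.≤-trans (ℕ.<⇒≤ m<d) (ℕ.m≤m+n d n)
  d+n∸m≡d : d + n ∸ m ≡ d
  d+n∸m≡d = trans (sym (ℕ.m≤n⇒∣m-n∣≡n∸m m≤d+n)) ∣m-d+n∣≡d

-- The antipodal pair {v_k, v_{k+d}} is {v (pole false k), v (pole true k)}. A facet of L picks one
-- pole from every pair, so facets are indexed by sign vectors ε : Vec Bool d.
module CrossPolytope (L : SimplicialComplex n) (d : ℕ) (v : Fin (d + d) → Fin n)
                     (labelling : IsCrossPolytopalLabelling L d v) where

  v-injective : Injective _≡_ _≡_ v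
  v-injective = proj₁ labelling

  L-simplex⇒clique : ∀ {σ} → simplex L σ → CliqueSimplex d v σ
  L-simplex⇒clique {σ} = Equivalence.to (proj₂ labelling σ)

  clique⇒L-simplex : ∀ {σ} → CliqueSimplex d v σ → simplex L σ
  clique⇒L-simplex {σ} = Equivalence.from (proj₂ labelling σ)

  pole : Bool → Fin d → Fin (d + d)
  pole false k = k Fin.↑ˡ d
  pole true  k = d Fin.↑ʳ k

  unpole : Fin (d + d) → Bool × Fin d
  unpole j = [ (false ,_) , (true ,_) ]′ (Fin.splitAt d j)

  unpole-pole : ∀ b k → unpole (pole b k) ≡ (b , k)
  unpole-pole false k = cong [ (false ,_) , (true ,_) ]′ (Fin.splitAt-↑ˡ d k d)
  unpole-pole true  k = cong [ (false ,_) , (true ,_) ]′ (Fin.splitAt-↑ʳ d d k)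

  pole-surjective : ∀ j → ∃₂ λ b k → pole b k ≡ j
  pole-surjective j with Fin.splitAt d j in split≡
  ... | inj₁ k = false , k , trans (cong (Fin.join d d) (sym split≡)) (Fin.join-splitAt d d j)
  ... | inj₂ k = true  , k , trans (cong (Fin.join d d) (sym split≡)) (Fin.join-splitAt d d j)

  pole-injective : ∀ {b b′ k k′} → pole b k ≡ pole b′ k′ → b ≡ b′ × k ≡ k′
  pole-injective {b} {b′} {k} {k′} eq
    with trans (sym (unpole-pole b k)) (trans (cong unpole eq) (unpole-pole b′ k′))
  ... | refl = refl , refl

  private
    distance : ∀ b k b′ k′ → ℕ
    distance b k b′ k′ = ∣ toℕ (pole b k) - toℕ (pole b′ k′) ∣

    distance-ff : ∀ k k′ → distance false k false k′ ≡ ∣ toℕ k - toℕ k′ ∣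
    distance-ff k k′ = cong₂ ∣_-_∣ (Fin.toℕ-↑ˡ k d) (Fin.toℕ-↑ˡ k′ d)

    distance-tt : ∀ k k′ → distance true k true k′ ≡ ∣ toℕ k - toℕ k′ ∣
    distance-tt k k′ = trans (cong₂ ∣_-_∣ (Fin.toℕ-↑ʳ d k) (Fin.toℕ-↑ʳ d k′))
                             (ℕ.∣m+n-m+o∣≡∣n-o∣ d (toℕ k) (toℕ k′))

    distance-ft : ∀ k k′ → distance false k true k′ ≡ ∣ toℕ k - d + toℕ k′ ∣
    distance-ft k k′ = cong₂ ∣_-_∣ (Fin.toℕ-↑ˡ k d) (Fin.toℕ-↑ʳ d k′)

    distance-tf : ∀ k k′ → distance true k false k′ ≡ ∣ toℕ k′ - d + toℕ k ∣
    distance-tf k k′ = trans (ℕ.∣-∣-comm (toℕ (pole true k)) (toℕ (pole false k′))) (distance-ft k′ k)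

    ∣k-d+k∣≡d : ∀ (k : Fin d) → ∣ toℕ k - d + toℕ k ∣ ≡ d
    ∣k-d+k∣≡d k = trans (cong (∣_-_∣ (toℕ k)) (ℕ.+-comm d (toℕ k))) (ℕ.∣m-m+n∣≡n (toℕ k) d)

  antipodal-pole : ∀ b k → Antipodal d (pole b k) (pole (not b) k)
  antipodal-pole false k = trans (distance-ft k k) (∣k-d+k∣≡d k)
  antipodal-pole true  k = trans (distance-tf k k) (∣k-d+k∣≡d k)

  antipodal-pole⁻ : ∀ b k b′ k′ → Antipodal d (pole b k) (pole b′ k′) → b′ ≡ not b × k′ ≡ k
  antipodal-pole⁻ false k false k′ anti =
    ⊥-elim (ℕ.<-irrefl (trans (sym (distance-ff k k′)) anti) (∣m-n∣<d (Fin.toℕ<n k) (Fin.toℕ<n k′)))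
  antipodal-pole⁻ true  k true  k′ anti =
    ⊥-elim (ℕ.<-irrefl (trans (sym (distance-tt k k′)) anti) (∣m-n∣<d (Fin.toℕ<n k) (Fin.toℕ<n k′)))
  antipodal-pole⁻ false k true  k′ anti =
    refl , sym (Fin.toℕ-injective (∣m-d+n∣≡d⇒m≡n (Fin.toℕ<n k) (trans (sym (distance-ft k k′)) anti)))
  antipodal-pole⁻ true  k false k′ anti =
    refl , Fin.toℕ-injective (∣m-d+n∣≡d⇒m≡n (Fin.toℕ<n k′) (trans (sym (distance-tf k k′)) anti))

  antipodal⇒≢ : ∀ {i j} → Antipodal d i j → i ≢ j
  antipodal⇒≢ {i} anti refl = ℕ.n≮0 (subst (λ e → toℕ i < e + e) d≡0 (Fin.toℕ<n i))
    where
    d≡0 : d ≡ 0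
    d≡0 = trans (sym anti) (ℕ.∣n-n∣≡0 (toℕ i))

  L-simplex-antipodeFree : ∀ {σ} → simplex L σ → AntipodeFree d v σ
  L-simplex-antipodeFree σ∈L i j anti vi∈σ vj∈σ =
    proj₂ (proj₂ (L-simplex⇒clique σ∈L)) i j (antipodal⇒≢ anti) vi∈σ vj∈σ anti

  vertex : Vec Bool d → Fin d → Fin n
  vertex ε k = v (pole (lookup ε k) k)

  vertex-injective : ∀ ε k ε′ k′ → vertex ε k ≡ vertex ε′ k′ → lookup ε k ≡ lookup ε′ k′ × k ≡ k′
  vertex-injective _ _ _ _ = pole-injective ∘ v-injective

  facet : Vec Bool d → Subset n
  facet ε = image (vertex ε)

  ∣facet∣ : ∀ ε → ∣ facet ε ∣ ≡ d
  ∣facet∣ ε = ∣image∣ (proj₂ ∘ vertex-injective ε _ ε _)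

  facet-injective : Injective _≡_ _≡_ facet
  facet-injective {ε} {ε′} facet≡ = lookup-ext pointwise
    where
    pointwise : ∀ k → lookup ε k ≡ lookup ε′ k
    pointwise k with ∈-image⁻ (vertex ε′) (subst (vertex ε k ∈_) facet≡ (∈-image⁺ (vertex ε) k))
    ... | k′ , vertex≡ with vertex-injective ε′ k′ ε k vertex≡
    ...   | same , refl = sym same

  facet-antipodeFree : ∀ ε → AntipodeFree d v (facet ε)
  facet-antipodeFree ε i j anti vi∈ vj∈
    with ∈-image⁻ (vertex ε) vi∈ | ∈-image⁻ (vertex ε) vj∈
  ... | k , vk≡vi | k′ , vk′≡vj
    with v-injective vk≡vi | v-injective vk′≡vj
  ... | refl | refl with antipodal-pole⁻ (lookup ε k) k (lookup ε k′) k′ anti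
  ...   | opposite , refl = Bool.not-¬ refl opposite

  facet∈L : Fin d → ∀ ε → simplex L (facet ε)
  facet∈L k₀ ε = clique⇒L-simplex (inhabited , in-image , adjacent)
    where
    inhabited : Nonempty (facet ε)
    inhabited = vertex ε k₀ , ∈-image⁺ (vertex ε) k₀
    in-image : ∀ x → x ∈ facet ε → ∃ λ i → v i ≡ x
    in-image x x∈ with ∈-image⁻ (vertex ε) x∈
    ... | k , vk≡x = pole (lookup ε k) k , vk≡x
    adjacent : ∀ i j → i ≢ j → v i ∈ facet ε → v j ∈ facet ε → Adjacent d i j
    adjacent i j _ vi∈ vj∈ anti = facet-antipodeFree ε i j anti vi∈ vj∈

  signsOf : Subset n → Vec Bool d
  signsOf τ = Vec.tabulate (λ k → does (v (pole true k) ∈? τ))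

  L-simplex⊆facet : ∀ {τ} → simplex L τ → τ ⊆ facet (signsOf τ)
  L-simplex⊆facet {τ} τ∈L {x} x∈τ with proj₁ (proj₂ (L-simplex⇒clique τ∈L)) x x∈τ
  ... | j , refl with pole-surjective j
  ...   | b , k , refl =
    subst (λ b′ → v (pole b′ k) ∈ facet (signsOf τ)) (sign≡ b x∈τ) (∈-image⁺ (vertex (signsOf τ)) k)
    where
    sign≡ : ∀ b → v (pole b k) ∈ τ → lookup (signsOf τ) k ≡ b
    sign≡ true  vt∈τ = trans (Vec.lookup∘tabulate _ k) (dec-true (v (pole true k) ∈? τ) vt∈τ)
    sign≡ false vf∈τ = trans (Vec.lookup∘tabulate _ k) (dec-false (v (pole true k) ∈? τ) λ vt∈τ →
      L-simplex-antipodeFree τ∈L (pole false k) (pole true k) (antipodal-pole false k) vf∈τ vt∈τ)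

  L-simplex≡facet : ∀ {τ} → simplex L τ → ∣ τ ∣ ≡ d → τ ≡ facet (signsOf τ)
  L-simplex≡facet {τ} τ∈L ∣τ∣≡d =
    ⊆∧∣≡∣⇒≡ (L-simplex⊆facet τ∈L) (trans ∣τ∣≡d (sym (∣facet∣ (signsOf τ))))

  maximal-antipodeFree≡facet : Fin d → ∀ {σ} → IsMaximalAntipodeFree L d v σ → σ ≡ facet (signsOf σ)
  maximal-antipodeFree≡facet k₀ {σ} (σ∈L , _ , maximal) =
    ⊆∧¬⊂⇒≡ (L-simplex⊆facet σ∈L)
            (maximal _ (facet∈L k₀ (signsOf σ)) (facet-antipodeFree (signsOf σ)))

  ridge : Vec Bool d → Fin d → Subset n
  ridge ε i = facet ε [ vertex ε i ]≔ outside

  vertex∈ridge : ∀ ε {i k} → k ≢ i → vertex ε k ∈ ridge ε i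
  vertex∈ridge ε {i} {k} k≢i =
    ∈-[]≔⁺ (k≢i ∘ proj₂ ∘ vertex-injective ε k ε i) (∈-image⁺ (vertex ε) k)

  ridge⊆ : ∀ {ε ε′} i → (∀ {k} → k ≢ i → lookup ε k ≡ lookup ε′ k) → ridge ε i ⊆ ridge ε′ i
  ridge⊆ {ε} {ε′} i agree {x} x∈ with ∈-image⁻ (vertex ε) ([]≔outside-⊆ x∈)
  ... | k , refl with k Fin.≟ i
  ...   | yes refl = ⊥-elim (x∉p[x]≔outside x∈)
  ...   | no  k≢i  = subst (λ b → v (pole b k) ∈ ridge ε′ i) (sym (agree k≢i)) (vertex∈ridge ε′ k≢i)

  ridge-flip : ∀ ε i → ridge (flip ε i) i ≡ ridge ε i
  ridge-flip ε i = ⊆-antisym (ridge⊆ {flip ε i} {ε} i (lookup-flip′ ε i))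
                             (ridge⊆ {ε} {flip ε i} i (sym ∘ lookup-flip′ ε i))

  facets-through-ridge : ∀ {e x} ε i → facet e [ x ]≔ outside ≡ ridge ε i → e ≡ ε ⊎ e ≡ flip ε i
  facets-through-ridge {e} ε i face≡ridge = ≡-or-flip ε i agree
    where
    agree : ∀ {k} → k ≢ i → lookup ε k ≡ lookup e k
    agree {k} k≢i
      with ∈-image⁻ (vertex e) ([]≔outside-⊆ (subst (vertex ε k ∈_) (sym face≡ridge) (vertex∈ridge ε k≢i)))
    ... | k′ , vertex≡ with vertex-injective e k′ ε k vertex≡
    ...   | same , refl = sym same

  -- Points outside the image of v get the junk coordinates (false , 0); they never occur below.
  coordinates : Fin n → Bool × ℕ
  coordinates x with Fin.any? (λ j → v j Fin.≟ x)
  ... | yes (j , _) = proj₁ (unpole j) , toℕ (proj₂ (unpole j))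
  ... | no  _       = false , 0

  coordinates-vertex : ∀ ε k → coordinates (vertex ε k) ≡ (lookup ε k , toℕ k)
  coordinates-vertex ε k with Fin.any? (λ j → v j Fin.≟ vertex ε k)
  ... | yes (j , vj≡) rewrite v-injective vj≡ | unpole-pole (lookup ε k) k = refl
  ... | no  ∄j        = ⊥-elim (∄j (_ , refl))

  open Orientation (proj₁ ∘ coordinates) (proj₂ ∘ coordinates)

  ridgeSign : Vec Bool d → Fin d → Bool
  ridgeSign ε i = facePosition (facet ε) (vertex ε i)

  orientedIncidence : Vec Bool d → Fin d → Bool
  orientedIncidence ε i = orientation (facet ε) xor ridgeSign ε i

  orientedIncidence-ridge : ∀ ε i → orientedIncidence ε i
    ≡ lookup ε i xor (orientation (ridge ε i) xor parity (λ x → proj₂ (coordinates x) <ᵇ toℕ i) (ridge ε i))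
  orientedIncidence-ridge ε i = begin
    orientation (facet ε) xor facePosition (facet ε) a
      ≡⟨ cong (λ S → orientation S xor facePosition S a) (sym (insert-remove (∈-image⁺ (vertex ε) i))) ⟩
    orientation (ρ [ a ]≔ inside) xor facePosition (ρ [ a ]≔ inside) a
      ≡⟨ orientation-insert x∉p[x]≔outside pairs-differ ⟩
    proj₁ (coordinates a) xor (orientation ρ xor parity (λ x → pair x <ᵇ pair a) ρ)
      ≡⟨ cong (λ (s , p) → s xor (orientation ρ xor parity (λ x → pair x <ᵇ p) ρ)) (coordinates-vertex ε i) ⟩
    lookup ε i xor (orientation ρ xor parity (λ x → pair x <ᵇ toℕ i) ρ)
      ∎
    where
    open ≡-Reasoning
    a = vertex ε i
    ρ = ridge ε i
    pair = proj₂ ∘ coordinates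
    pairs-differ : ∀ {x} → x ∈ ρ → pair x ≢ pair a
    pairs-differ {x} x∈ρ with ∈-image⁻ (vertex ε) ([]≔outside-⊆ x∈ρ)
    ... | k , refl rewrite coordinates-vertex ε k | coordinates-vertex ε i = λ k≡i →
      x∉p[x]≔outside (subst (λ k → vertex ε k ∈ ρ) (Fin.toℕ-injective k≡i) x∈ρ)

  orientedIncidence-flip : ∀ ε i → orientedIncidence (flip ε i) i ≡ not (orientedIncidence ε i)
  orientedIncidence-flip ε i = begin
    orientedIncidence (flip ε i) i
      ≡⟨ orientedIncidence-ridge (flip ε i) i ⟩
    lookup (flip ε i) i xor R (ridge (flip ε i) i)
      ≡⟨ cong₂ (λ s ρ → s xor R ρ) (lookup-flip ε i) (ridge-flip ε i) ⟩
    not (lookup ε i) xor R (ridge ε i)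
      ≡⟨ sym (Bool.not-distribˡ-xor (lookup ε i) _) ⟩
    not (lookup ε i xor R (ridge ε i))
      ≡⟨ cong not (sym (orientedIncidence-ridge ε i)) ⟩
    not (orientedIncidence ε i)
      ∎
    where
    open ≡-Reasoning
    R : Subset n → Bool
    R ρ = orientation ρ xor parity (λ x → proj₂ (coordinates x) <ᵇ toℕ i) ρ

  incidence-ridge : ∀ ε i → incidence (facet ε) (ridge ε i) ≡ sgn (ridgeSign ε i)
  incidence-ridge ε i = incidence-face (∈-image⁺ (vertex ε) i)

  incidence-ridge-flip : ∀ ε i → incidence (facet (flip ε i)) (ridge ε i) ≡ sgn (ridgeSign (flip ε i) i)
  incidence-ridge-flip ε i =
    subst (λ ρ → incidence (facet (flip ε i)) ρ ≡ sgn (ridgeSign (flip ε i) i))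
          (ridge-flip ε i) (incidence-ridge (flip ε i) i)

  incidence-other-facet : ∀ {τ} ε i → simplex L τ → ∣ τ ∣ ≡ d → τ ≢ facet ε → τ ≢ facet (flip ε i) →
                          incidence τ (ridge ε i) ≡ 0ℤ
  incidence-other-facet {τ} ε i τ∈L ∣τ∣≡d τ≢F τ≢F′ =
    decidable-stable (incidence τ (ridge ε i) ℤ.≟ 0ℤ) (through-ridge ∘ incidence≢0⇒face τ)
    where
    τ≡F : τ ≡ facet (signsOf τ)
    τ≡F = L-simplex≡facet τ∈L ∣τ∣≡d
    through-ridge : (∃ λ x → x ∈ τ × τ [ x ]≔ outside ≡ ridge ε i) → ⊥
    through-ridge (x , _ , face≡ridge)
      with facets-through-ridge {signsOf τ} ε i (subst (λ σ → σ [ x ]≔ outside ≡ ridge ε i) τ≡F face≡ridge)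
    ... | inj₁ e≡ε  = τ≢F (trans τ≡F (cong facet e≡ε))
    ... | inj₂ e≡ε′ = τ≢F′ (trans τ≡F (cong facet e≡ε′))

  coeff-∂-ridge : ∀ {z} → IsChain L d z → ∀ ε i → coeff (∂ z) (ridge ε i)
    ≡ coeff z (facet ε) ℤ.* sgn (ridgeSign ε i) ℤ.+ coeff z (facet (flip ε i)) ℤ.* sgn (ridgeSign (flip ε i) i)
  coeff-∂-ridge {z} z∈L ε i = begin
    coeff (∂ z) (ridge ε i)
      ≡⟨ coeff-∂ z (ridge ε i) ⟩
    evaluate z (λ τ → incidence τ (ridge ε i))
      ≡⟨ evaluate-two z (flip≢ ε i ∘ sym ∘ facet-injective)
                        (All.map (λ (τ∈L , ∣τ∣≡d) → incidence-other-facet ε i τ∈L ∣τ∣≡d) z∈L) ⟩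
    coeff z (facet ε) ℤ.* incidence (facet ε) (ridge ε i)
      ℤ.+ coeff z (facet (flip ε i)) ℤ.* incidence (facet (flip ε i)) (ridge ε i)
      ≡⟨ cong₂ (λ s t → coeff z (facet ε) ℤ.* s ℤ.+ coeff z (facet (flip ε i)) ℤ.* t)
               (incidence-ridge ε i) (incidence-ridge-flip ε i) ⟩
    coeff z (facet ε) ℤ.* sgn (ridgeSign ε i) ℤ.+ coeff z (facet (flip ε i)) ℤ.* sgn (ridgeSign (flip ε i) i)
      ∎
    where open ≡-Reasoning

  coeff-∂≢0⇒ridge : ∀ {z ρ} → IsChain L d z → coeff (∂ z) ρ ≢ 0ℤ → ∃₂ λ ε i → ridge ε i ≡ ρ
  coeff-∂≢0⇒ridge {z} {ρ} z∈L c≢0 =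
    All.lookupWith (λ {e} → ridge-of-facet {e}) z∈L (evaluate≢0⇒Any z (c≢0 ∘ trans (coeff-∂ z ρ)))
    where
    ridge-of-facet : ∀ {e : ℤ × Subset n} → simplex L (proj₂ e) × ∣ proj₂ e ∣ ≡ d →
                     incidence (proj₂ e) ρ ≢ 0ℤ → ∃₂ λ ε i → ridge ε i ≡ ρ
    ridge-of-facet {_ , τ} (τ∈L , ∣τ∣≡d) i≢0 with L-simplex≡facet τ∈L ∣τ∣≡d | incidence≢0⇒face τ i≢0
    ... | τ≡F | x , x∈τ , face≡ρ with ∈-image⁻ (vertex (signsOf τ)) (subst (x ∈_) τ≡F x∈τ)
    ...   | i , refl = signsOf τ , i , subst (λ σ → σ [ x ]≔ outside ≡ ρ) τ≡F face≡ρ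

  cycle-coeff≡0-flip : ∀ {z} → IsChain L d z → IsCycle z → ∀ ε i →
                       coeff z (facet ε) ≡ 0ℤ → coeff z (facet (flip ε i)) ≡ 0ℤ
  cycle-coeff≡0-flip {z} z∈L cycle ε i c≡0 = *sgn≡0⇒≡0 (coeff z (facet ε′)) (ridgeSign ε′ i) (begin
    coeff z (facet ε′) ℤ.* sgn (ridgeSign ε′ i)
      ≡⟨ sym (ℤ.+-identityˡ _) ⟩
    0ℤ ℤ.* sgn (ridgeSign ε i) ℤ.+ coeff z (facet ε′) ℤ.* sgn (ridgeSign ε′ i)
      ≡⟨ cong (λ c → c ℤ.* sgn (ridgeSign ε i) ℤ.+ coeff z (facet ε′) ℤ.* sgn (ridgeSign ε′ i)) (sym c≡0) ⟩
    coeff z (facet ε) ℤ.* sgn (ridgeSign ε i) ℤ.+ coeff z (facet ε′) ℤ.* sgn (ridgeSign ε′ i)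
      ≡⟨ sym (coeff-∂-ridge z∈L ε i) ⟩
    coeff (∂ z) (ridge ε i)
      ≡⟨ cycle (ridge ε i) ⟩
    0ℤ ∎)
    where
    open ≡-Reasoning
    ε′ = flip ε i

  facet-coeff≡0⇒cycle≈[] : ∀ {z} → IsChain L d z → IsCycle z → ∀ ε₀ → coeff z (facet ε₀) ≡ 0ℤ → z ≈ᶜ []
  facet-coeff≡0⇒cycle≈[] {z} z∈L cycle ε₀ c≡0 τ =
    decidable-stable (coeff z τ ℤ.≟ 0ℤ) λ c≢0 →
      c≢0 (All.lookupWith (λ {e} → vanishes {e}) z∈L (coeff≢0⇒Any z c≢0))
    where
    on-facets : ∀ ε → coeff z (facet ε) ≡ 0ℤ
    on-facets = cube-induction (λ ε → coeff z (facet ε) ≡ 0ℤ) (cycle-coeff≡0-flip z∈L cycle) ε₀ c≡0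
    vanishes : ∀ {e : ℤ × Subset n} → simplex L (proj₂ e) × ∣ proj₂ e ∣ ≡ d → proj₂ e ≡ τ → coeff z τ ≡ 0ℤ
    vanishes (τ∈L , ∣τ∣≡d) refl =
      subst (λ σ → coeff z σ ≡ 0ℤ) (sym (L-simplex≡facet τ∈L ∣τ∣≡d)) (on-facets (signsOf τ))

  fundamentalCycle : Chain n
  fundamentalCycle = cubeChain d (sgn ∘ orientation ∘ facet) facet

  fundamentalCycle∈L : Fin d → IsChain L d fundamentalCycle
  fundamentalCycle∈L k₀ = All-cubeChain d (λ ε → facet∈L k₀ ε , ∣facet∣ ε)

  coeff-fundamentalCycle : ∀ ε → coeff fundamentalCycle (facet ε) ≡ sgn (orientation (facet ε))
  coeff-fundamentalCycle = coeff-cubeChain d facet-injective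

  fundamentalCycle-isCycle : Fin d → IsCycle fundamentalCycle
  fundamentalCycle-isCycle k₀ ρ =
    decidable-stable (coeff (∂ fundamentalCycle) ρ ℤ.≟ 0ℤ) λ c≢0 →
      let ε , i , ridge≡ρ = coeff-∂≢0⇒ridge (fundamentalCycle∈L k₀) c≢0
      in c≢0 (subst (λ ρ → coeff (∂ fundamentalCycle) ρ ≡ 0ℤ) ridge≡ρ (cancels ε i))
    where
    open ≡-Reasoning
    term : ∀ ε i → coeff fundamentalCycle (facet ε) ℤ.* sgn (ridgeSign ε i) ≡ sgn (orientedIncidence ε i)
    term ε i = trans (cong (ℤ._* sgn (ridgeSign ε i)) (coeff-fundamentalCycle ε))
                     (sym (sgn-xor (orientation (facet ε)) (ridgeSign ε i)))
    cancels : ∀ ε i → coeff (∂ fundamentalCycle) (ridge ε i) ≡ 0ℤ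
    cancels ε i = begin
      coeff (∂ fundamentalCycle) (ridge ε i)
        ≡⟨ coeff-∂-ridge (fundamentalCycle∈L k₀) ε i ⟩
      coeff fundamentalCycle (facet ε) ℤ.* sgn (ridgeSign ε i)
        ℤ.+ coeff fundamentalCycle (facet (flip ε i)) ℤ.* sgn (ridgeSign (flip ε i) i)
        ≡⟨ cong₂ ℤ._+_ (term ε i) (trans (term (flip ε i) i) (cong sgn (orientedIncidence-flip ε i))) ⟩
      sgn b ℤ.+ sgn (not b)
        ≡⟨ cong (λ t → sgn b ℤ.+ t) (sgn-not b) ⟩
      sgn b ℤ.- sgn b
        ≡⟨ ℤ.+-inverseʳ (sgn b) ⟩
      0ℤ ∎
      where b = orientedIncidence ε i

lemma2p4 : ∀ {n} (K L : SimplicialComplex n) (d : ℕ) → 1 ≤ d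
    → L ≤ₛ K
    → (v : Fin (d + d) → Fin n) → IsCrossPolytopalLabelling L d v
    → (∃ λ σ → IsMaximalAntipodeFree L d v σ × IsMaximalSimplex K σ)
    → (∀ z → IsChain L d z → IsCycle z → IsBoundaryIn K d z → IsBoundaryIn L d z)
      × (∃ λ z → IsChain K d z × IsCycle z × ¬ IsBoundaryIn K d z)
lemma2p4 K L d 1≤d L≤K v labelling (σ₀ , σ₀-maximal-in-L , σ₀-maximal-in-K) =
  (λ z z∈L cycle bounds → [] , [] , sym ∘ facet-coeff≡0⇒cycle≈[] z∈L cycle ε₀ (coeff-ε₀ z bounds)) ,
  (fundamentalCycle , All.map (map₁ L≤K) (fundamentalCycle∈L k₀) , fundamentalCycle-isCycle k₀ ,
   λ bounds → sgn≢0 _ (trans (sym (coeff-fundamentalCycle ε₀)) (coeff-ε₀ fundamentalCycle bounds)))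
  where
  open CrossPolytope L d v labelling
  k₀ = Fin.fromℕ< 1≤d
  ε₀ = signsOf σ₀
  coeff-ε₀ : ∀ z → IsBoundaryIn K d z → coeff z (facet ε₀) ≡ 0ℤ
  coeff-ε₀ z bounds = subst (λ σ → coeff z σ ≡ 0ℤ) (maximal-antipodeFree≡facet k₀ σ₀-maximal-in-L)
                            (coeff-boundary-maximal {K = K} {σ₀} {d} {z} σ₀-maximal-in-K bounds)
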